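{- Let $\mathcal{S}=\{S_1,\dots,S_N\}\subseteq 2^{[n]}$ be a Sperner family with $N\ge 1$ and $h:\mathcal{S}\to 2^{[n]}$ a function with $H_i=h(S_i)\subseteq S_i$ for every $i\in[N]$. Let $G_{\mathcal{S},h}$ be the graph with vertex set $\{(S_i,H_i): i\in[N]\}$ in which $(S_i,H_i)$ and $(S_j,H_j)$ ($i\ne j$) are adjacent if and only if $S_i\cap H_j=S_j\cap H_i$. If $G_{\mathcal{S},h}$ is the complete graph on $N$ vertices, then there exists $S_0\in\mathcal{S}$ such that $\mathcal{Q}_{S_0,h(S_0)}\not\subseteq\bigcup_{S\in\mathcal{S}\setminus\{S_0\}}\mathcal{Q}_{S,h(S)}$.
   Context: $[n]=\{1,\dots,n\}$. A Sperner family is a family of sets none of whose members contains another. For $H\subseteq S\subseteq[n]$ let $\mathcal{Q}_{S,H}=\{H\cup B: B\subseteq[n]\setminus S\}$, i.e. the family of subsets $F\subseteq[n]$ with $F\cap S=H$. -}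

module Defs where

open import Data.Nat using (ℕ)
open import Data.Fin using (Fin)
open import Data.Fin.Subset using (Subset; _⊆_; _∩_)
open import Relation.Binary.PropositionalEquality using (_≡_)
open import Relation.Nullary using (¬_)

-- An indexed family S₁,…,S_N of subsets of [n] is Sperner:
-- no member contains another (for distinct indices).
-- In particular the S_i are pairwise distinct, so the family has exactly N members.
IsSperner : {n N : ℕ} → (Fin N → Subset n) → Set
IsSperner {n} {N} S = ∀ (i j : Fin N) → ¬ (i ≡ j) → ¬ (S i ⊆ S j)

_∈Q[_,_] : {n : ℕ} → Subset n → Subset n → Subset n → Set
F ∈Q[ S , H ] = F ∩ S ≡ H

Adjacent : {n N : ℕ} → (Fin N → Subset n) → (Fin N → Subset n) → Fin N → Fin N → Set
Adjacent S H i j = S i ∩ H j ≡ S j ∩ H i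

IsComplete : {n N : ℕ} → (Fin N → Subset n) → (Fin N → Subset n) → Set
IsComplete {N = N} S H = ∀ (i j : Fin N) → ¬ (i ≡ j) → Adjacent S H i j

module Submission where

-- Every index works as S₀; we take i₀ = 0.  Let U = ⋃ₖ Hₖ and
--   F = H₀ ∪ ∁ (S₀ ∪ U),
-- i.e. F agrees with H₀ on S₀ and, outside S₀, contains exactly the points
-- lying in no Hₖ.  Since H₀ ⊆ S₀ we get F ∩ S₀ = H₀, so F ∈ Q_{S₀,H₀}.
-- Completeness of G_{S,h} says: for x ∈ Sⱼ, if x ∈ Hₖ for some k then
-- x ∈ Hⱼ (adjacency of k and j at the point x).  Hence on Sⱼ \ S₀ the set F
-- is exactly the complement of Hⱼ.  For j ≠ 0 the Sperner property supplies a
-- point x ∈ Sⱼ \ S₀, where F and Hⱼ therefore disagree; so F ∩ Sⱼ ≠ Hⱼ.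

open import Defs
open import Level using (Level)
open import Data.Nat using (ℕ; _≥_; suc; s≤s; z≤n)
open import Data.Fin using (Fin; zero) renaming (_≟_ to _≟ᶠ_)
open import Data.Fin.Properties using (any?; ¬∀⟶∃¬)
open import Data.Fin.Subset using (Subset; _⊆_; _∩_; _∪_; ∁; _∈_; _∉_)
open import Data.Fin.Subset.Properties
  using (_∈?_; ⊆-antisym; x∈p∩q⁺; x∈p∩q⁻; x∈p∪q⁺; x∈p∪q⁻; x∉p⇒x∈∁p; x∈∁p⇒x∉p)
open import Data.Vec using (tabulate)
open import Data.Vec.Properties using (lookup∘tabulate; lookup⇒[]=; []=⇒lookup)
open import Data.Bool using (true)
open import Data.Product using (Σ; ∃; _×_; _,_; proj₁; proj₂)
open import Data.Sum using (inj₁; inj₂)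
open import Relation.Binary.PropositionalEquality using (_≡_; refl; sym; trans; subst)
open import Relation.Nullary using (¬_; Dec; yes; no; does; contradiction)
open import Relation.Nullary.Decidable using (dec-true; _→-dec_)
open import Relation.Unary using (Pred; Decidable)

private
  variable
    ℓ : Level
    A : Set ℓ
    n N : ℕ

does-true⇒ : (a? : Dec A) → does a? ≡ true → A
does-true⇒ (yes a) _ = a
does-true⇒ (no _) ()

⟦_⟧ : {P : Pred (Fin n) ℓ} → Decidable P → Subset n
⟦ P? ⟧ = tabulate (λ x → does (P? x))

∈⟦⟧⁺ : {P : Pred (Fin n) ℓ} (P? : Decidable P) {x : Fin n} → P x → x ∈ ⟦ P? ⟧
∈⟦⟧⁺ P? {x} px = lookup⇒[]= x _ (trans (lookup∘tabulate _ x) (dec-true (P? x) px))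

∈⟦⟧⁻ : {P : Pred (Fin n) ℓ} (P? : Decidable P) {x : Fin n} → x ∈ ⟦ P? ⟧ → P x
∈⟦⟧⁻ P? {x} x∈ = does-true⇒ (P? x) (trans (sym (lookup∘tabulate _ x)) ([]=⇒lookup x∈))

⋃ᶠ : (Fin N → Subset n) → Subset n
⋃ᶠ H = ⟦ (λ x → any? (λ k → x ∈? H k)) ⟧

∈⋃ᶠ⁺ : (H : Fin N → Subset n) {x : Fin n} (k : Fin N) → x ∈ H k → x ∈ ⋃ᶠ H
∈⋃ᶠ⁺ H k x∈Hₖ = ∈⟦⟧⁺ (λ x → any? (λ k → x ∈? H k)) (k , x∈Hₖ)

∈⋃ᶠ⁻ : (H : Fin N → Subset n) {x : Fin n} → x ∈ ⋃ᶠ H → ∃ λ k → x ∈ H k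
∈⋃ᶠ⁻ H = ∈⟦⟧⁻ (λ x → any? (λ k → x ∈? H k))

⊈⇒witness : {p q : Subset n} → ¬ (p ⊆ q) → ∃ λ x → x ∈ p × x ∉ q
⊈⇒witness {n} {p} {q} p⊈q with ¬∀⟶∃¬ n _ (λ x → (x ∈? p) →-dec (x ∈? q)) (λ all → p⊈q (all _))
... | x , ¬[x∈p⇒x∈q] with x ∈? p
...   | yes x∈p = x , x∈p , λ x∈q → ¬[x∈p⇒x∈q] (λ _ → x∈q)
...   | no  x∉p = contradiction (λ x∈p → contradiction x∈p x∉p) ¬[x∈p⇒x∈q]

∈Q⇒agree : {F S H : Subset n} → F ∈Q[ S , H ] → {x : Fin n} → x ∈ S →
           (x ∈ F → x ∈ H) × (x ∈ H → x ∈ F)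
∈Q⇒agree {F = F} {S} refl x∈S = (λ x∈F → x∈p∩q⁺ (x∈F , x∈S)) , (λ x∈F∩S → proj₁ (x∈p∩q⁻ F S x∈F∩S))

agree⇒∈Q : {F S H : Subset n} → H ⊆ S →
           (∀ {x} → x ∈ S → x ∈ F → x ∈ H) → (∀ {x} → x ∈ H → x ∈ F) → F ∈Q[ S , H ]
agree⇒∈Q {F = F} {S} H⊆S F⇒H H⇒F = ⊆-antisym
  (λ x∈F∩S → let (x∈F , x∈S) = x∈p∩q⁻ F S x∈F∩S in F⇒H x∈S x∈F)
  (λ x∈H → x∈p∩q⁺ (H⇒F x∈H , H⊆S x∈H))

-- Absorption: if G_{S,h} is complete and x ∈ Sⱼ, then x lies in Hⱼ as soon as
-- it lies in any Hₖ.  (At x, adjacency reads  Sₖ(x) ∧ Hⱼ(x) = Sⱼ(x) ∧ Hₖ(x).)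
complete⇒absorb : {S H : Fin N → Subset n} → IsComplete S H → (∀ i → H i ⊆ S i) →
                  ∀ {j k x} → x ∈ S j → x ∈ H k → x ∈ H j
complete⇒absorb {S = S} {H} complete H⊆S {j} {k} {x} x∈Sⱼ x∈Hₖ with k ≟ᶠ j
... | yes refl = x∈Hₖ
... | no  k≢j  = proj₂ (x∈p∩q⁻ (S k) (H j) x∈Sₖ∩Hⱼ)
  where
  x∈Sₖ∩Hⱼ : x ∈ S k ∩ H j
  x∈Sₖ∩Hⱼ = subst (_ ∈_) (sym (complete k j k≢j)) (x∈p∩q⁺ (x∈Sⱼ , x∈Hₖ))

witness : (S H : Fin N → Subset n) → Fin N → Subset n
witness S H i₀ = H i₀ ∪ ∁ (S i₀ ∪ ⋃ᶠ H)

module _ (S H : Fin N → Subset n) (H⊆S : ∀ i → H i ⊆ S i) (i₀ : Fin N) where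

  private
    F : Subset n
    F = witness S H i₀

  witness-∈Q : F ∈Q[ S i₀ , H i₀ ]
  witness-∈Q = agree⇒∈Q (H⊆S i₀) F⇒H₀ (λ x∈H₀ → x∈p∪q⁺ (inj₁ x∈H₀))
    where
    F⇒H₀ : ∀ {x} → x ∈ S i₀ → x ∈ F → x ∈ H i₀
    F⇒H₀ {x} x∈S₀ x∈F with x∈p∪q⁻ (H i₀) _ x∈F
    ... | inj₁ x∈H₀ = x∈H₀
    ... | inj₂ x∈∁  = contradiction (x∈p∪q⁺ (inj₁ x∈S₀)) (x∈∁p⇒x∉p x∈∁)

  witness-outside⁺ : ∀ {x} → x ∉ S i₀ → (∀ k → x ∉ H k) → x ∈ F
  witness-outside⁺ {x} x∉S₀ x∉H = x∈p∪q⁺ (inj₂ (x∉p⇒x∈∁p x∉S₀∪U))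
    where
    x∉S₀∪U : x ∉ S i₀ ∪ ⋃ᶠ H
    x∉S₀∪U x∈ with x∈p∪q⁻ (S i₀) _ x∈
    ... | inj₁ x∈S₀ = x∉S₀ x∈S₀
    ... | inj₂ x∈U  = let (k , x∈Hₖ) = ∈⋃ᶠ⁻ H x∈U in x∉H k x∈Hₖ

  witness-outside⁻ : ∀ {x k} → x ∉ S i₀ → x ∈ H k → x ∉ F
  witness-outside⁻ {x} {k} x∉S₀ x∈Hₖ x∈F with x∈p∪q⁻ (H i₀) _ x∈F
  ... | inj₁ x∈H₀ = x∉S₀ (H⊆S i₀ x∈H₀)
  ... | inj₂ x∈∁  = x∈∁p⇒x∉p x∈∁ (x∈p∪q⁺ (inj₂ (∈⋃ᶠ⁺ H k x∈Hₖ)))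

  witness-∉Q : IsComplete S H → ∀ {j x} → x ∈ S j → x ∉ S i₀ → ¬ (F ∈Q[ S j , H j ])
  witness-∉Q complete {j} {x} x∈Sⱼ x∉S₀ F∈Q with x ∈? H j
  ... | yes x∈Hⱼ = witness-outside⁻ x∉S₀ x∈Hⱼ (proj₂ (∈Q⇒agree F∈Q x∈Sⱼ) x∈Hⱼ)
  ... | no  x∉Hⱼ = x∉Hⱼ (proj₁ (∈Q⇒agree F∈Q x∈Sⱼ) (witness-outside⁺ x∉S₀ x∉H))
    where
    x∉H : ∀ k → x ∉ H k
    x∉H k x∈Hₖ = x∉Hⱼ (complete⇒absorb complete H⊆S x∈Sⱼ x∈Hₖ)

claim20 : (n N : ℕ) → N ≥ 1 → (S H : Fin N → Subset n) → IsSperner S → (∀ i → H i ⊆ S i) → IsComplete S H → Σ (Fin N) (λ i₀ → Σ (Subset n) (λ F → (F ∈Q[ S i₀ , H i₀ ]) × (∀ j → ¬ (j ≡ i₀) → ¬ (F ∈Q[ S j , H j ]))))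
claim20 n (suc N) (s≤s z≤n) S H sperner H⊆S complete =
  zero , witness S H zero , witness-∈Q S H H⊆S zero , F∉Qⱼ
  where
  F∉Qⱼ : ∀ j → ¬ (j ≡ zero) → ¬ (witness S H zero ∈Q[ S j , H j ])
  F∉Qⱼ j j≢0 with ⊈⇒witness (sperner j zero j≢0)
  ... | x , x∈Sⱼ , x∉S₀ = witness-∉Q S H H⊆S zero complete x∈Sⱼ x∉S₀
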